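{- Let $G\neq P_n$ be a caterpillar tree on $n$ vertices with diameter $D$ and exactly two centroidal vertices, which have equal degrees. Suppose $P=v_0v_1\ldots v_D$ is a diametric path in $G$ such that $v_j,v_{j+1}\in P$ are the centroidal vertices and each of the vertices $v_0,\ldots,v_{j-1},v_{j+2},\ldots,v_D$ has degree at most $2$. Then $\rho(P_n)-r(P_n)\leq\rho(G)-r(G)$.
   Context: $P_n$ is the path on $n$ vertices. A caterpillar tree is a tree in which removing all leaves yields a path. $d(u,v)$ is the length of a shortest $u$–$v$ path; $e(v)=\max_u d(v,u)$; radius $r(G)=\min_v e(v)$; the diameter $D=\max_v e(v)$, and a diametric path is a shortest path between two vertices at distance $D$. The normalized transmission of $v$ is $\pi(v)=\frac{1}{n-1}\sum_u d(v,u)$, the remoteness is $\rho(G)=\max_v\pi(v)$, and a vertex $v$ is centroidal if $\pi(v)=\min_u \pi(u)$. -}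

module Defs where

open import Data.Nat as ℕ using (ℕ; zero; suc; _+_; _∸_; _≤_)
open import Data.Fin as Fin using (Fin; toℕ; inject₁; fromℕ)
open import Data.Fin.Properties using (_≟_)
open import Data.Bool using (Bool; true; false; _∧_; _∨_; if_then_else_)
open import Data.List using (List; map; allFin)
open import Data.Nat.ListAction using (sum)
open import Data.Bool.ListAction using (any)
open import Data.Integer using (+_)
open import Data.Rational as ℚ using (ℚ)
open import Data.Product using (Σ; ∃; _×_; _,_)
open import Data.Sum using (_⊎_)
open import Function using (_∘_)
open import Function.Definitions using (Injective)
open import Relation.Nullary using (¬_)
open import Relation.Nullary.Decidable using (⌊_⌋)
open import Relation.Binary.PropositionalEquality using (_≡_; _≢_; refl; cong)
import Relation.Binary.PropositionalEquality as Eq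
open import Data.Bool.Properties using (∨-comm)

record Graph (n : ℕ) : Set where
  field
    adj    : Fin n → Fin n → Bool
    sym    : ∀ u v → adj u v ≡ adj v u
    irrefl : ∀ u → adj u u ≡ false
open Graph public

module _ {n : ℕ} (G : Graph n) where

  deg : Fin n → ℕ
  deg v = sum (map (λ u → if adj G v u then 1 else 0) (allFin n))

  reach : ℕ → Fin n → Fin n → Bool
  reach zero    u v = ⌊ u ≟ v ⌋
  reach (suc k) u v = reach k u v ∨ any (λ w → adj G u w ∧ reach k w v) (allFin n)

  Connected : Set
  Connected = ∀ u v → ∃ λ k → reach k u v ≡ true

  -- acyclic: no cycle c₀ c₁ … c_{k+2} c₀ (k+3 ≥ 3 distinct vertices)
  Acyclic : Set
  Acyclic = ∀ k (c : Fin (suc (suc (suc k))) → Fin n) → Injective _≡_ _≡_ c →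
    ¬ ((∀ (i : Fin (suc (suc k))) → adj G (c (inject₁ i)) (c (Fin.suc i)) ≡ true)
       × adj G (c (fromℕ (suc (suc k)))) (c Fin.zero) ≡ true)

  IsTree : Set
  IsTree = Connected × Acyclic

-- least k ≥ start (searching with the given fuel) such that f k = true;
-- returns start + fuel if none is found
search : (ℕ → Bool) → ℕ → ℕ → ℕ
search f start zero       = start
search f start (suc fuel) = if f start then start else search f (suc start) fuel

module _ {n : ℕ} (G : Graph n) where

  -- distance d(u,v): least k such that a u–v walk of length ≤ k exists
  -- (correct for connected graphs, where it is at most n - 1)
  dist : Fin n → Fin n → ℕ
  dist u v = search (λ k → reach G k u v) 0 n

  trans : Fin n → ℕ
  trans v = sum (map (dist v) (allFin n))

  -- leaves are vertices of degree 1; the non-leaves span, after deleting all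
  -- leaves, the induced subgraph on {v | deg v ≠ 1}
  NonLeaf : Fin n → Set
  NonLeaf v = deg G v ≢ 1

  -- the induced subgraph on the non-leaves is a path (possibly empty):
  -- its vertices can be listed w₀ … w_m injectively, every non-leaf occurs,
  -- and w_i w_j is an edge iff |i - j| = 1
  LeafDeletedIsPath : Set
  LeafDeletedIsPath =
    (∀ v → ¬ NonLeaf v) ⊎
    (Σ ℕ λ m → Σ (Fin (suc m) → Fin n) λ w →
       Injective _≡_ _≡_ w × (∀ i → NonLeaf (w i)) ×
       (∀ v → NonLeaf v → ∃ λ i → w i ≡ v) ×
       (∀ i j → (toℕ i ≡ suc (toℕ j)) ⊎ (toℕ j ≡ suc (toℕ i)) → adj G (w i) (w j) ≡ true) ×
       (∀ i j → adj G (w i) (w j) ≡ true → (toℕ i ≡ suc (toℕ j)) ⊎ (toℕ j ≡ suc (toℕ i))))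

  IsCaterpillar : Set
  IsCaterpillar = IsTree G × LeafDeletedIsPath

fold1 : {A : Set} {k : ℕ} → (A → A → A) → (Fin (suc k) → A) → A
fold1 {k = zero}  _∙_ f = f Fin.zero
fold1 {k = suc k} _∙_ f = f Fin.zero ∙ fold1 _∙_ (f ∘ Fin.suc)

module _ {k : ℕ} (G : Graph (suc k)) where

  ecc : Fin (suc k) → ℕ
  ecc v = fold1 ℕ._⊔_ (dist G v)

  radius : ℕ
  radius = fold1 ℕ._⊓_ ecc

  diameter : ℕ
  diameter = fold1 ℕ._⊔_ ecc

module _ {m : ℕ} (G : Graph (suc (suc m))) where

  -- normalized transmission π(v) = σ(v) / (n - 1), here n = m + 2
  π : Fin (suc (suc m)) → ℚ
  π v = (+ trans G v) ℚ./ suc m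

  remoteness : ℚ
  remoteness = fold1 ℚ._⊔_ π

  Centroidal : Fin (suc (suc m)) → Set
  Centroidal v = π v ≡ fold1 ℚ._⊓_ π

pathAdj : {n : ℕ} → Fin n → Fin n → Bool
pathAdj i j = (toℕ i ℕ.≡ᵇ suc (toℕ j)) ∨ (toℕ j ℕ.≡ᵇ suc (toℕ i))

≡ᵇ-suc : ∀ a → (a ℕ.≡ᵇ suc a) ≡ false
≡ᵇ-suc zero    = refl
≡ᵇ-suc (suc a) = ≡ᵇ-suc a

pathAdj-irrefl : {n : ℕ} (i : Fin n) → pathAdj i i ≡ false
pathAdj-irrefl i rewrite ≡ᵇ-suc (toℕ i) = refl

pathGraph : (n : ℕ) → Graph n
pathGraph n = record
  { adj    = pathAdj
  ; sym    = λ i j → ∨-comm (toℕ i ℕ.≡ᵇ suc (toℕ j)) (toℕ j ℕ.≡ᵇ suc (toℕ i))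
  ; irrefl = pathAdj-irrefl
  }

-- graph isomorphism G ≅ H (an injective, hence bijective, map on Fin n
-- preserving adjacency and non-adjacency)
_≅_ : {n : ℕ} → Graph n → Graph n → Set
_≅_ {n} G H = Σ (Fin n → Fin n) λ f → Injective _≡_ _≡_ f × (∀ u v → adj G u v ≡ adj H (f u) (f v))

ℕ→ℚ : ℕ → ℚ
ℕ→ℚ k = (+ k) ℚ./ 1

-- Both differences are compared with 0.  The path Pₙ has ρ ≤ r as soon as n = 2h is even:
-- every vertex has transmission at most h(n − 1) and eccentricity at least h.  Evenness
-- comes from the adjacent centroidal vertices v_j, v_{j+1}: their transmissions agree,
-- while d(v_j, w) + d(v_{j+1}, w) is odd for every vertex w, because in a caterpillar
-- every vertex lies on the diametric path or is a leaf hanging at an interior vertex of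
-- it.  The same description of G shows that the middle vertex of the path has
-- eccentricity ⌈D/2⌉, and that σ(v_0) + σ(v_D) ≥ (n − 1)(D + 1), so one end of the path
-- has π ≥ ⌈D/2⌉; hence r(G) ≤ ρ(G).

module Submission where

open import Defs
open import Algebra.Construct.NaturalChoice.Base using (MinOperator; MaxOperator; MaxOp⇒MinOp)
import Algebra.Construct.NaturalChoice.MinOp as MinOp
open import Data.Bool using (Bool; true; false; _∧_; _∨_; if_then_else_)
open import Data.Bool.Properties using (T-≡; ∨-zeroʳ)
open import Data.Bool.ListAction using (any)
open import Data.Empty using (⊥; ⊥-elim)
open import Data.Fin as Fin using (Fin; toℕ; inject₁; fromℕ; punchIn; punchOut)
import Data.Fin.Properties as Finₚ
open import Data.Integer as ℤ using (+≤+)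
import Data.Integer.Properties as ℤₚ
open import Data.List using (allFin; map; tabulate)
open import Data.List.Properties using (map-tabulate)
open import Data.List.Membership.Propositional using (lose)
open import Data.List.Membership.Propositional.Properties using (∈-allFin)
open import Data.List.Relation.Unary.Any using (satisfied)
open import Data.List.Relation.Unary.Any.Properties using (any⁺; any⁻)
open import Data.Nat as ℕ using (ℕ; zero; suc; _+_; _*_; _∸_; _≤_; _<_; z≤n; s≤s; ∣_-_∣; ⌊_/2⌋; ⌈_/2⌉)
import Data.Nat.ListAction as List
open import Data.Nat.Properties
open import Data.Nat.Tactic.RingSolver using (solve-∀)
open import Data.Product using (Σ; ∃; ∃₂; ∄; _×_; _,_; proj₁; proj₂)
open import Data.Rational as ℚ using (_-_) renaming (_≤_ to _≤ℚ_)
import Data.Rational.Properties as ℚₚ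
open import Data.Rational.Unnormalised using (mkℚᵘ; *≤*)
import Data.Rational.Unnormalised.Properties as ℚᵘₚ
open import Data.Sum using (_⊎_; inj₁; inj₂; [_,_]′)
open import Function using (_∘_; Equivalence)
open import Function.Definitions using (Injective)
open import Level using (0ℓ)
open import Relation.Binary.Bundles using (TotalPreorder)
open import Relation.Binary.PropositionalEquality as ≡
  using (_≡_; _≢_; refl; cong; cong₂; subst; subst₂; module ≡-Reasoning)
open import Relation.Nullary using (¬_; yes; no; Dec; does)
open import Relation.Nullary.Decidable using (isYes≗does; dec-true; dec-false; decidable-stable)

open import Algebra.Properties.CommutativeMonoid.Sum +-0-commutativeMonoid
  using (sum; ∑-distrib-+; ∑-comm; sum-cong-≗; sum-remove)
open import Algebra.Properties.CommutativeSemigroup +-commutativeSemigroup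
  using () renaming (interchange to +-interchange)

private
  variable
    k : ℕ

∨-introˡ : ∀ {a} b → a ≡ true → a ∨ b ≡ true
∨-introˡ b refl = refl

∨-introʳ : ∀ a {b} → b ≡ true → a ∨ b ≡ true
∨-introʳ a refl = ∨-zeroʳ a

∨-elim : ∀ a {b} → a ∨ b ≡ true → a ≡ true ⊎ b ≡ true
∨-elim true  _ = inj₁ refl
∨-elim false e = inj₂ e

any-allFin⁺ : (p : Fin k → Bool) (a : Fin k) → p a ≡ true → any p (allFin k) ≡ true
any-allFin⁺ p a pa = Equivalence.to T-≡ (any⁺ p (lose (∈-allFin a) (Equivalence.from T-≡ pa)))

any-allFin⁻ : (p : Fin k → Bool) → any p (allFin k) ≡ true → ∃ λ a → p a ≡ true
any-allFin⁻ p e with a , pa ← satisfied (any⁻ p (allFin _) (Equivalence.from T-≡ e)) =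
  a , Equivalence.to T-≡ pa

search-least : ∀ f start fuel k → f k ≡ true → start ≤ k → search f start fuel ≤ k
search-least f start zero       k fk start≤k = start≤k
search-least f start (suc fuel) k fk start≤k with f start in eq
... | true  = start≤k
... | false with m≤n⇒m<n∨m≡n start≤k
...   | inj₁ start<k  = search-least f (suc start) fuel k fk start<k
...   | inj₂ refl with () ← ≡.trans (≡.sym eq) fk

search-bounded : ∀ f start fuel → search f start fuel ≤ start + fuel
search-bounded f start zero       = ≤-reflexive (≡.sym (+-identityʳ start))
search-bounded f start (suc fuel) with f start
... | true  = m≤m+n start (suc fuel)
... | false = ≤-trans (search-bounded f (suc start) fuel) (≤-reflexive (≡.sym (+-suc start fuel)))

search-found : ∀ f start fuel → search f start fuel < start + fuel → f (search f start fuel) ≡ true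
search-found f start zero       lt = ⊥-elim (<-irrefl (≡.sym (+-identityʳ start)) lt)
search-found f start (suc fuel) lt with f start in eq
... | true  = eq
... | false = search-found f (suc start) fuel (subst (search f (suc start) fuel <_) (+-suc start fuel) lt)

search-cong : ∀ {f g} → (∀ k → f k ≡ g k) → ∀ start fuel → search f start fuel ≡ search g start fuel
search-cong f≗g start zero = refl
search-cong {g = g} f≗g start (suc fuel) rewrite f≗g start with g start
... | true  = refl
... | false = search-cong f≗g (suc start) fuel

-- Finite sums

sum-tabulate : (f : Fin k → ℕ) → List.sum (tabulate f) ≡ sum f
sum-tabulate {zero}  f = refl
sum-tabulate {suc k} f = cong (f Fin.zero +_) (sum-tabulate (f ∘ Fin.suc))

sum-allFin : (f : Fin k → ℕ) → List.sum (map f (allFin k)) ≡ sum f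
sum-allFin f = ≡.trans (cong List.sum (map-tabulate (λ i → i) f)) (sum-tabulate f)

sum-mono-≤ : {f g : Fin k → ℕ} → (∀ i → f i ≤ g i) → sum f ≤ sum g
sum-mono-≤ {zero}  f≤g = z≤n
sum-mono-≤ {suc k} f≤g = +-mono-≤ (f≤g Fin.zero) (sum-mono-≤ (f≤g ∘ Fin.suc))

term≤sum : (f : Fin k → ℕ) (a : Fin k) → f a ≤ sum f
term≤sum f Fin.zero    = m≤m+n _ _
term≤sum f (Fin.suc a) = ≤-trans (term≤sum (f ∘ Fin.suc) a) (m≤n+m _ _)

two-terms≤sum : (f : Fin k → ℕ) {a b : Fin k} → a ≢ b → f a + f b ≤ sum f
two-terms≤sum {suc k} f {a} {b} a≢b = begin
  f a + f b                                ≡⟨ cong (λ c → f a + f c) (Finₚ.punchIn-punchOut a≢b) ⟨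
  f a + f (punchIn a (punchOut a≢b))       ≤⟨ +-monoʳ-≤ (f a) (term≤sum (f ∘ punchIn a) (punchOut a≢b)) ⟩
  f a + sum (f ∘ punchIn a)                ≡⟨ sum-remove f ⟨
  sum f                                    ∎
  where
  open ≤-Reasoning

sum-const : ∀ k c → sum {k} (λ _ → c) ≡ k * c
sum-const zero    c = refl
sum-const (suc k) c = cong (c +_) (sum-const k c)

sum-zero : ∀ k → sum {k} (λ _ → 0) ≡ 0
sum-zero k = ≡.trans (sum-const k 0) (*-zeroʳ k)

sum-suc : (f : Fin k → ℕ) → sum (λ i → suc (f i)) ≡ k + sum f
sum-suc {k} f = ≡.trans (∑-distrib-+ (λ _ → 1) f) (cong (_+ sum f) (≡.trans (sum-const k 1) (*-identityʳ k)))

sum-pos : (f : Fin k → ℕ) → 1 ≤ sum f → ∃ λ i → 1 ≤ f i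
sum-pos {suc k} f 1≤Σ with f Fin.zero in eq
... | suc _ = Fin.zero , subst (1 ≤_) (≡.sym eq) (s≤s z≤n)
... | zero  with i , 1≤fi ← sum-pos (f ∘ Fin.suc) 1≤Σ = Fin.suc i , 1≤fi

sum-pos-avoiding : (f : Fin k → ℕ) (a : Fin k) → suc (f a) ≤ sum f → ∃ λ b → b ≢ a × 1 ≤ f b
sum-pos-avoiding {suc k} f a fa<Σ
  with i , 1≤fi ← sum-pos (f ∘ punchIn a) (+-cancelˡ-≤ (f a) 1 _ (subst₂ _≤_ (+-comm 1 (f a)) (sum-remove f) fa<Σ)) =
  punchIn a i , Finₚ.punchInᵢ≢i a i , 1≤fi

δ : Fin k → Fin k → ℕ
δ a b = if does (a Finₚ.≟ b) then 1 else 0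

δ-refl : (a : Fin k) → δ a a ≡ 1
δ-refl a rewrite dec-true (a Finₚ.≟ a) refl = refl

δ-≢ : {a b : Fin k} → a ≢ b → δ a b ≡ 0
δ-≢ {a = a} {b} a≢b rewrite dec-false (a Finₚ.≟ b) a≢b = refl

sum-δ : (a : Fin k) → sum (δ a) ≡ 1
sum-δ {suc k} a = begin
  sum (δ a)                            ≡⟨ sum-remove (δ a) ⟩
  δ a a + sum (δ a ∘ punchIn a)        ≡⟨ cong₂ _+_ (δ-refl a) (sum-cong-≗ (λ j → δ-≢ (Finₚ.punchInᵢ≢i a j ∘ ≡.sym))) ⟩
  1 + sum {k} (λ _ → 0)                ≡⟨ cong suc (sum-zero k) ⟩
  1                                    ∎
  where open ≡-Reasoning

2[1+N]+[1+N]N≡[2+N][1+N] : ∀ N → 2 * suc N + suc N * N ≡ suc (suc N) * suc N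
2[1+N]+[1+N]N≡[2+N][1+N] = solve-∀

sum-toℕ : ∀ N → 2 * sum {suc N} toℕ ≡ suc N * N
sum-toℕ zero    = refl
sum-toℕ (suc N) = begin
  2 * sum {suc N} (suc ∘ toℕ)        ≡⟨ cong (2 *_) (sum-suc {suc N} toℕ) ⟩
  2 * (suc N + sum {suc N} toℕ)      ≡⟨ *-distribˡ-+ 2 (suc N) _ ⟩
  2 * suc N + 2 * sum {suc N} toℕ    ≡⟨ cong (2 * suc N +_) (sum-toℕ N) ⟩
  2 * suc N + suc N * N              ≡⟨ 2[1+N]+[1+N]N≡[2+N][1+N] N ⟩
  suc (suc N) * suc N                ∎
  where open ≡-Reasoning

sum-∣-∣≤ : ∀ N i → i ≤ N → 2 * sum {suc N} (λ k → ∣ i - toℕ k ∣) ≤ suc N * N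
sum-∣-∣≤ N       zero    _         = ≤-reflexive (sum-toℕ N)
sum-∣-∣≤ (suc N) (suc i) (s≤s i≤N) = begin
  2 * (suc i + S)              ≡⟨ *-distribˡ-+ 2 (suc i) S ⟩
  2 * suc i + 2 * S            ≤⟨ +-mono-≤ (*-monoʳ-≤ 2 (s≤s i≤N)) (sum-∣-∣≤ N i i≤N) ⟩
  2 * suc N + suc N * N        ≡⟨ 2[1+N]+[1+N]N≡[2+N][1+N] N ⟩
  suc (suc N) * suc N          ∎
  where
  open ≤-Reasoning
  S = sum {suc N} (λ k → ∣ i - toℕ k ∣)

∣-∣-consecutive-odd : ∀ y x → ∃ λ q → ∣ y - x ∣ + ∣ suc y - x ∣ ≡ suc (q + q)
∣-∣-consecutive-odd zero    zero    = 0 , refl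
∣-∣-consecutive-odd zero    (suc x) = x , refl
∣-∣-consecutive-odd (suc y) zero    = suc y , cong suc (+-suc y (suc y))
∣-∣-consecutive-odd (suc y) (suc x) = ∣-∣-consecutive-odd y x

t+t≡k+[h+h]⇒k≡[t∸h]+[t∸h] : ∀ k t h → t + t ≡ k + (h + h) → k ≡ (t ∸ h) + (t ∸ h)
t+t≡k+[h+h]⇒k≡[t∸h]+[t∸h] k t h eq with h ≤? t
... | yes h≤t = +-cancelʳ-≡ (h + h) k _ (begin
  k + (h + h)                    ≡⟨ eq ⟨
  t + t                          ≡⟨ cong₂ _+_ (m∸n+n≡m h≤t) (m∸n+n≡m h≤t) ⟨
  (t ∸ h + h) + (t ∸ h + h)      ≡⟨ +-interchange (t ∸ h) h (t ∸ h) h ⟩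
  (t ∸ h + (t ∸ h)) + (h + h)    ∎)
  where open ≡-Reasoning
... | no  h≰t = ⊥-elim (<⇒≱ (+-mono-< t<h t<h) (≤-trans (m≤n+m (h + h) k) (≤-reflexive (≡.sym eq))))
  where t<h = ≰⇒> h≰t

m≤o⇒n≤m+o⇒∣m-n∣≤o : ∀ {c E i} → c ≤ E → i ≤ c + E → ∣ c - i ∣ ≤ E
m≤o⇒n≤m+o⇒∣m-n∣≤o {c} {E} {i} c≤E i≤c+E with ≤-total c i
... | inj₁ c≤i rewrite m≤n⇒∣m-n∣≡n∸m c≤i = m≤n+o⇒m∸n≤o i c i≤c+E
... | inj₂ i≤c rewrite m≤n⇒∣n-m∣≡n∸m i≤c = ≤-trans (m∸n≤m c i) c≤E

m≤o⇒1≤n⇒n<m+o⇒1+∣m-n∣≤o : ∀ {c E k} → c ≤ E → 1 ≤ k → suc k ≤ c + E → suc ∣ c - k ∣ ≤ E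
m≤o⇒1≤n⇒n<m+o⇒1+∣m-n∣≤o {c} {E} {k} c≤E 1≤k k<c+E with ≤-total c k
... | inj₁ c≤k rewrite m≤n⇒∣m-n∣≡n∸m c≤k | ≡.sym (+-∸-assoc 1 c≤k) = m≤n+o⇒m∸n≤o (suc k) c k<c+E
... | inj₂ k≤c rewrite m≤n⇒∣n-m∣≡n∸m k≤c = ≤-trans (∸-monoʳ-< 1≤k k≤c) c≤E

x+x≤y+z⇒x≤y⊎x≤z : ∀ x y z → x + x ≤ y + z → x ≤ y ⊎ x ≤ z
x+x≤y+z⇒x≤y⊎x≤z x y z le with x ≤? y | x ≤? z
... | yes x≤y | _       = inj₁ x≤y
... | no  _   | yes x≤z = inj₂ x≤z
... | no  x≰y | no  x≰z = ⊥-elim (<⇒≱ (+-mono-< (≰⇒> x≰y) (≰⇒> x≰z)) le)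

injective⇒surjective : ∀ {m k} {f : Fin m → Fin (suc k)} → Injective _≡_ _≡_ f → suc k ≤ m →
                       ∀ a → ∃ λ t → f t ≡ a
injective⇒surjective {m} {k} {f} f-injective k<m a with Finₚ.any? (λ t → f t Finₚ.≟ a)
... | yes hit  = hit
... | no  miss = ⊥-elim (<⇒≱ k<m (Finₚ.injective⇒≤ g-injective))
  where
  g : Fin m → Fin k
  g t = punchOut {i = a} (miss ∘ (t ,_) ∘ ≡.sym)

  g-injective : Injective _≡_ _≡_ g
  g-injective {t} {t′} = f-injective ∘ Finₚ.punchOut-injective (miss ∘ (t ,_) ∘ ≡.sym) (miss ∘ (t′ ,_) ∘ ≡.sym)

-- t as an element of Fin (suc L), truncated to L when t > L
clamp : (L t : ℕ) → Fin (suc L)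
clamp L       zero    = Fin.zero
clamp zero    (suc t) = Fin.zero
clamp (suc L) (suc t) = Fin.suc (clamp L t)

toℕ-clamp : ∀ {L t} → t ≤ L → toℕ (clamp L t) ≡ t
toℕ-clamp {L}     {zero}  _         = refl
toℕ-clamp {suc L} {suc t} (s≤s t≤L) = cong suc (toℕ-clamp t≤L)

clamp-toℕ : ∀ {L} (i : Fin (suc L)) → clamp L (toℕ i) ≡ i
clamp-toℕ {L}     Fin.zero    = refl
clamp-toℕ {suc L} (Fin.suc i) = cong Fin.suc (clamp-toℕ i)

module _ {ℓ₁ ℓ₂} {O : TotalPreorder 0ℓ ℓ₁ ℓ₂} (minOp : MinOperator O) where
  open TotalPreorder O using (_≲_) renaming (Carrier to A; refl to ≲-refl; trans to ≲-trans)
  open MinOperator minOp using (_⊓_)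
  module Min = MinOp minOp

  fold1-⊓-lower : (f : Fin (suc k) → A) (i : Fin (suc k)) → fold1 _⊓_ f ≲ f i
  fold1-⊓-lower {zero}  f Fin.zero    = ≲-refl
  fold1-⊓-lower {suc k} f Fin.zero    = Min.x⊓y≤x _ _
  fold1-⊓-lower {suc k} f (Fin.suc i) = ≲-trans (Min.x⊓y≤y _ _) (fold1-⊓-lower (f ∘ Fin.suc) i)

  fold1-⊓-greatest : (f : Fin (suc k) → A) {b : A} → (∀ i → b ≲ f i) → b ≲ fold1 _⊓_ f
  fold1-⊓-greatest {zero}  f b≤f = b≤f Fin.zero
  fold1-⊓-greatest {suc k} f b≤f = Min.⊓-glb (b≤f Fin.zero) (fold1-⊓-greatest (f ∘ Fin.suc) (b≤f ∘ Fin.suc))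

module _ {ℓ₁ ℓ₂} {O : TotalPreorder 0ℓ ℓ₁ ℓ₂} (maxOp : MaxOperator O) where
  open TotalPreorder O using (_≲_) renaming (Carrier to A)
  open MaxOperator maxOp using (_⊔_)

  fold1-⊔-upper : (f : Fin (suc k) → A) (i : Fin (suc k)) → f i ≲ fold1 _⊔_ f
  fold1-⊔-upper = fold1-⊓-lower (MaxOp⇒MinOp maxOp)

  fold1-⊔-least : (f : Fin (suc k) → A) {b : A} → (∀ i → f i ≲ b) → fold1 _⊔_ f ≲ b
  fold1-⊔-least = fold1-⊓-greatest (MaxOp⇒MinOp maxOp)

ℕ/-mono-≤ : ∀ t m t′ m′ → t * suc m′ ≤ t′ * suc m → (ℤ.+ t) ℚ./ suc m ≤ℚ (ℤ.+ t′) ℚ./ suc m′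
ℕ/-mono-≤ t m t′ m′ le = ℚₚ.toℚᵘ-cancel-≤
  (ℚᵘₚ.≤-respʳ-≃ (ℚᵘₚ.≃-sym (ℚₚ.toℚᵘ-fromℚᵘ (mkℚᵘ (ℤ.+ t′) m′)))
  (ℚᵘₚ.≤-respˡ-≃ (ℚᵘₚ.≃-sym (ℚₚ.toℚᵘ-fromℚᵘ (mkℚᵘ (ℤ.+ t) m)))
    (*≤* (subst₂ ℤ._≤_ (ℤₚ.pos-* t (suc m′)) (ℤₚ.pos-* t′ (suc m)) (+≤+ le)))))

ℕ/-injective : ∀ t t′ m → (ℤ.+ t) ℚ./ suc m ≡ (ℤ.+ t′) ℚ./ suc m → t ≡ t′
ℕ/-injective t t′ m e = *-cancelʳ-≡ t t′ (suc m) (ℚₚ.normalize-injective-≃ t t′ (suc m) (suc m) e)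

ℕ→ℚ-mono-≤ : ∀ a b → a ≤ b → ℕ→ℚ a ≤ℚ ℕ→ℚ b
ℕ→ℚ-mono-≤ a b a≤b = ℕ/-mono-≤ a 0 b 0 (*-monoˡ-≤ 1 a≤b)

p≤q⇒s≤r⇒p-q≤r-s : ∀ {p q r s} → p ≤ℚ q → s ≤ℚ r → p - q ≤ℚ r - s
p≤q⇒s≤r⇒p-q≤r-s {p} {q} {r} {s} p≤q s≤r = begin
  p - q  ≤⟨ ℚₚ.+-monoˡ-≤ (ℚ.- q) p≤q ⟩
  q - q  ≡⟨ ℚₚ.+-inverseʳ q ⟩
  ℚ.0ℚ   ≡⟨ ℚₚ.+-inverseʳ s ⟨
  s - s  ≤⟨ ℚₚ.+-monoˡ-≤ (ℚ.- s) s≤r ⟩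
  r - s  ∎
  where open ℚₚ.≤-Reasoning

-- Walks and distances

module GraphTheory {n : ℕ} (G : Graph n) where

  V : Set
  V = Fin n

  infix 4 _~_
  _~_ : V → V → Set
  u ~ v = adj G u v ≡ true

  Reach : ℕ → V → V → Set
  Reach k u v = reach G k u v ≡ true

  Pendant : V → V → Set
  Pendant w u = w ~ u × (∀ y → w ~ y → y ≡ u)

  Lipschitz : (V → ℕ) → Set
  Lipschitz φ = ∀ {x y} → x ~ y → φ x ≤ suc (φ y)

  ~-sym : ∀ {u v} → u ~ v → v ~ u
  ~-sym {u} {v} u~v = ≡.trans (sym G v u) u~v

  reach-refl : ∀ k u → Reach k u u
  reach-refl zero    u = ≡.trans (isYes≗does (u Finₚ.≟ u)) (dec-true (u Finₚ.≟ u) refl)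
  reach-refl (suc k) u = ∨-introˡ _ (reach-refl k u)

  reach-zero : ∀ {u v} → Reach 0 u v → u ≡ v
  reach-zero {u} {v} r with u Finₚ.≟ v
  ... | yes u≡v = u≡v
  reach-zero () | no _

  reach-suc : ∀ k {u v} → Reach k u v → Reach (suc k) u v
  reach-suc k = ∨-introˡ _

  reach-cons : ∀ k {u w v} → u ~ w → Reach k w v → Reach (suc k) u v
  reach-cons k {u} {w} {v} u~w r =
    ∨-introʳ (reach G k u v) (any-allFin⁺ (λ x → adj G u x ∧ reach G k x v) w (subst (λ b → b ∧ reach G k w v ≡ true) (≡.sym u~w) r))

  reach-uncons : ∀ k {u v} → Reach (suc k) u v → Reach k u v ⊎ ∃ λ w → u ~ w × Reach k w v
  reach-uncons k {u} {v} r with ∨-elim (reach G k u v) r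
  ... | inj₁ r′ = inj₁ r′
  ... | inj₂ r′ with w , s ← any-allFin⁻ (λ x → adj G u x ∧ reach G k x v) r′ with adj G u w in u~w
  ...   | true = inj₂ (w , u~w , s)

  reach-trans : ∀ a b {u w v} → Reach a u w → Reach b w v → Reach (a + b) u v
  reach-trans zero    b r s rewrite reach-zero r = s
  reach-trans (suc a) b r s with reach-uncons a r
  ... | inj₁ r′            = reach-suc (a + b) (reach-trans a b r′ s)
  ... | inj₂ (x , u~x , r′) = reach-cons (a + b) u~x (reach-trans a b r′ s)

  reach-snoc : ∀ k {u w v} → Reach k u w → w ~ v → Reach (suc k) u v
  reach-snoc k {u} {v = v} r w~v =
    subst (λ z → Reach z u v) (+-comm k 1) (reach-trans k 1 r (reach-cons 0 w~v (reach-refl 0 v)))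

  reach-sym : ∀ k {u v} → Reach k u v → Reach k v u
  reach-sym zero    r rewrite reach-zero r = reach-refl 0 _
  reach-sym (suc k) r with reach-uncons k r
  ... | inj₁ r′            = reach-suc k (reach-sym k r′)
  ... | inj₂ (x , u~x , r′) = reach-snoc k (reach-sym k r′) (~-sym u~x)

  reach-lipschitz : ∀ {φ} → Lipschitz φ → ∀ k {u v} → Reach k u v → φ u ≤ k + φ v
  reach-lipschitz L zero    r rewrite reach-zero r = ≤-refl
  reach-lipschitz L (suc k) r with reach-uncons k r
  ... | inj₁ r′            = m≤n⇒m≤1+n (reach-lipschitz L k r′)
  ... | inj₂ (x , u~x , r′) = ≤-trans (L u~x) (s≤s (reach-lipschitz L k r′))

  reach-neighbour : ∀ k {u v} → Reach k u v → u ≢ v → ∃ (u ~_)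
  reach-neighbour zero    r u≢v = ⊥-elim (u≢v (reach-zero r))
  reach-neighbour (suc k) r u≢v with reach-uncons k r
  ... | inj₁ r′           = reach-neighbour k r′ u≢v
  ... | inj₂ (x , u~x , _) = x , u~x

  reach-pendant : ∀ k {w u x} → Pendant w u → x ≢ w → Reach (suc k) w x → Reach k u x
  reach-pendant k       (_ , uniq) x≢w r with reach-uncons k r
  reach-pendant zero    (_ , uniq) x≢w r | inj₁ r′ = ⊥-elim (x≢w (≡.sym (reach-zero r′)))
  reach-pendant (suc k) p          x≢w r | inj₁ r′ = reach-suc k (reach-pendant k p x≢w r′)
  reach-pendant k       (_ , uniq) x≢w r | inj₂ (y , w~y , r′) rewrite uniq y w~y = r′


  trans≡sum : ∀ v → trans G v ≡ sum (dist G v)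
  trans≡sum v = sum-allFin (dist G v)

  dist≤ : ∀ k {u v} → Reach k u v → dist G u v ≤ k
  dist≤ k r = search-least _ 0 n k r z≤n

  dist≤n : ∀ u v → dist G u v ≤ n
  dist≤n u v = search-bounded _ 0 n

  reach-dist : ∀ u v → dist G u v < n → Reach (dist G u v) u v
  reach-dist u v = search-found (λ k → reach G k u v) 0 n

  dist-sym : ∀ u v → dist G u v ≡ dist G v u
  dist-sym u v = search-cong (λ k → reach-sym-≡ k u v) 0 n
    where
    reach-sym-≡ : ∀ k u v → reach G k u v ≡ reach G k v u
    reach-sym-≡ k u v with reach G k u v in r | reach G k v u in s
    ... | true  | true  = refl
    ... | false | false = refl
    ... | true  | false = ≡.trans (≡.sym (reach-sym k r)) s
    ... | false | true  = ≡.trans (≡.sym r) (reach-sym k s)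

  dist-triangle : ∀ u w v → dist G u v ≤ dist G u w + dist G w v
  dist-triangle u w v with dist G u w ℕ.<? n | dist G w v ℕ.<? n
  ... | yes p | yes q = dist≤ _ (reach-trans (dist G u w) (dist G w v) (reach-dist u w p) (reach-dist w v q))
  ... | no p  | _     = ≤-trans (dist≤n u v) (≤-trans (≮⇒≥ p) (m≤m+n _ _))
  ... | yes _ | no q  = ≤-trans (dist≤n u v) (≤-trans (≮⇒≥ q) (m≤n+m _ _))

  dist-adjacent : ∀ {u v} → u ~ v → dist G u v ≤ 1
  dist-adjacent u~v = dist≤ 1 (reach-cons 0 u~v (reach-refl 0 _))

  dist-lipschitz : ∀ φ → Lipschitz φ → ∀ u v → dist G u v < n → φ u ∸ φ v ≤ dist G u v
  dist-lipschitz φ L u v d<n = begin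
    φ u ∸ φ v                  ≤⟨ ∸-monoˡ-≤ (φ v) (reach-lipschitz L _ (reach-dist u v d<n)) ⟩
    dist G u v + φ v ∸ φ v     ≡⟨ m+n∸n≡m (dist G u v) (φ v) ⟩
    dist G u v                 ∎
    where open ≤-Reasoning

  dist-pendant : ∀ {w u x} → Pendant w u → x ≢ w → dist G w x < n → suc (dist G u x) ≤ dist G w x
  dist-pendant {w} {u} {x} p x≢w d<n with dist G w x | reach-dist w x d<n
  ... | zero  | r = ⊥-elim (x≢w (≡.sym (reach-zero r)))
  ... | suc k | r = s≤s (dist≤ k (reach-pendant k p x≢w r))

  module _ (Q : ℕ → V) (L : ℕ) (walk : ∀ t → t < L → Q t ~ Q (suc t)) where

    reach-along : ∀ a e → a + e ≤ L → Reach e (Q a) (Q (a + e))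
    reach-along a zero    _ rewrite +-identityʳ a = reach-refl 0 (Q a)
    reach-along a (suc e) le rewrite +-suc a e =
      reach-snoc e (reach-along a e (<⇒≤ le)) (walk (a + e) le)

    dist-along-≤ : ∀ {a b} → a ≤ b → b ≤ L → dist G (Q a) (Q b) ≤ b ∸ a
    dist-along-≤ {a} {b} a≤b b≤L = dist≤ (b ∸ a)
      (subst (λ c → Reach (b ∸ a) (Q a) (Q c)) (m+[n∸m]≡n a≤b)
        (reach-along a (b ∸ a) (subst (_≤ L) (≡.sym (m+[n∸m]≡n a≤b)) b≤L)))

    dist-along : ∀ a b → a ≤ L → b ≤ L → dist G (Q a) (Q b) ≤ ∣ a - b ∣
    dist-along a b a≤L b≤L with ≤-total a b
    ... | inj₁ a≤b rewrite m≤n⇒∣m-n∣≡n∸m a≤b = dist-along-≤ a≤b b≤L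
    ... | inj₂ b≤a rewrite m≤n⇒∣n-m∣≡n∸m b≤a | dist-sym (Q a) (Q b) = dist-along-≤ b≤a a≤L

  Leaf : V → Set
  Leaf v = deg G v ≡ 1

  leaf? : ∀ v → Dec (Leaf v)
  leaf? v = deg G v ℕ.≟ 1

  indicator : V → V → ℕ
  indicator v u = if adj G v u then 1 else 0

  deg-sum : ∀ v → deg G v ≡ sum (indicator v)
  deg-sum v = sum-allFin (indicator v)

  indicator-pos : ∀ {v u} → 1 ≤ indicator v u → v ~ u
  indicator-pos {v} {u} _ with adj G v u
  indicator-pos _ | true = refl

  indicator-adjacent : ∀ {v u} → v ~ u → indicator v u ≡ 1
  indicator-adjacent v~u rewrite v~u = refl

  two-neighbours⇒deg≥2 : ∀ {v a b} → v ~ a → v ~ b → a ≢ b → 2 ≤ deg G v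
  two-neighbours⇒deg≥2 {v} {a} {b} v~a v~b a≢b = begin
    2                                 ≡⟨ cong₂ _+_ (indicator-adjacent v~a) (indicator-adjacent v~b) ⟨
    indicator v a + indicator v b     ≤⟨ two-terms≤sum (indicator v) a≢b ⟩
    sum (indicator v)                 ≡⟨ deg-sum v ⟨
    deg G v                           ∎
    where open ≤-Reasoning

  leaf-neighbour-unique : ∀ {v a b} → v ~ a → v ~ b → Leaf v → a ≡ b
  leaf-neighbour-unique {v} {a} {b} v~a v~b leaf with a Finₚ.≟ b
  ... | yes a≡b = a≡b
  ... | no  a≢b = ⊥-elim (1+n≰n (subst (2 ≤_) leaf (two-neighbours⇒deg≥2 v~a v~b a≢b)))

  deg≥1⇒neighbour : ∀ v → 1 ≤ deg G v → ∃ (v ~_)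
  deg≥1⇒neighbour v 1≤deg with u , 1≤ind ← sum-pos (indicator v) (subst (1 ≤_) (deg-sum v) 1≤deg) =
    u , indicator-pos 1≤ind

  deg≥2⇒two-neighbours : ∀ v → 2 ≤ deg G v → ∃₂ λ a b → a ≢ b × v ~ a × v ~ b
  deg≥2⇒two-neighbours v 2≤deg with a , v~a ← deg≥1⇒neighbour v (≤-trans (s≤s z≤n) 2≤deg)
    with b , b≢a , 1≤ind ← sum-pos-avoiding (indicator v) a (subst (_≤ sum (indicator v))
                              (cong suc (≡.sym (indicator-adjacent v~a))) (subst (2 ≤_) (deg-sum v) 2≤deg)) =
    a , b , b≢a ∘ ≡.sym , v~a , indicator-pos 1≤ind

  leaf-pendant : ∀ {w u} → w ~ u → Leaf w → Pendant w u
  leaf-pendant w~u leaf = w~u , λ y w~y → leaf-neighbour-unique w~y w~u leaf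

  leaf⇒pendant : ∀ w → Leaf w → ∃ (Pendant w)
  leaf⇒pendant w leaf with u , w~u ← deg≥1⇒neighbour w (≤-reflexive (≡.sym leaf)) = u , leaf-pendant w~u leaf

  module _ (connected : Connected G) where

    connected⇒deg≥1 : ∀ {u v} → u ≢ v → 1 ≤ deg G u
    connected⇒deg≥1 {u} {v} u≢v with k , r ← connected u v with a , u~a ← reach-neighbour k r u≢v = begin
      1                  ≡⟨ indicator-adjacent u~a ⟨
      indicator u a      ≤⟨ term≤sum (indicator u) a ⟩
      sum (indicator u)  ≡⟨ deg-sum u ⟨
      deg G u            ∎
      where open ≤-Reasoning

    adjacent-leaves-cover : ∀ {l l′} → l ~ l′ → Leaf l → Leaf l′ → ∀ x → x ≡ l ⊎ x ≡ l′
    adjacent-leaves-cover {l} {l′} l~l′ leaf leaf′ x = closed (proj₁ (connected l x)) (inj₁ refl) (proj₂ (connected l x))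
      where
      step : ∀ {z y} → z ≡ l ⊎ z ≡ l′ → z ~ y → y ≡ l ⊎ y ≡ l′
      step (inj₁ refl) z~y = inj₂ (leaf-neighbour-unique z~y l~l′ leaf)
      step (inj₂ refl) z~y = inj₁ (leaf-neighbour-unique z~y (~-sym l~l′) leaf′)

      closed : ∀ k {z} → z ≡ l ⊎ z ≡ l′ → Reach k z x → x ≡ l ⊎ x ≡ l′
      closed zero    z∈ r rewrite reach-zero r = z∈
      closed (suc k) z∈ r with reach-uncons k r
      ... | inj₁ r′            = closed k z∈ r′
      ... | inj₂ (y , z~y , r′) = closed k (step z∈ z~y) r′

dist≤diameter : ∀ {k} (G : Graph (suc k)) u v → dist G u v ≤ diameter G
dist≤diameter G u v = ≤-trans (fold1-⊔-upper ⊔-operator (dist G u) v) (fold1-⊔-upper ⊔-operator (ecc G) u)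

module _ {m : ℕ} (G : Graph (suc (suc m))) where

  ℕ→ℚ≤remoteness : ∀ v h → h * suc m ≤ trans G v → ℕ→ℚ h ≤ℚ remoteness G
  ℕ→ℚ≤remoteness v h le = ℚₚ.≤-trans (ℕ/-mono-≤ h 0 (trans G v) m (subst (h * suc m ≤_) (≡.sym (*-identityʳ (trans G v))) le))
                                       (fold1-⊔-upper ℚₚ.⊔-operator (π G) v)

  remoteness≤ℕ→ℚ : ∀ h → (∀ v → trans G v ≤ h * suc m) → remoteness G ≤ℚ ℕ→ℚ h
  remoteness≤ℕ→ℚ h le = fold1-⊔-least ℚₚ.⊔-operator (π G)
    (λ v → ℕ/-mono-≤ (trans G v) m h 0 (subst (_≤ h * suc m) (≡.sym (*-identityʳ (trans G v))) (le v)))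

-- Caterpillars with a diametric path

module DiametricPath {m : ℕ} (G : Graph (suc (suc m))) (caterpillar : IsCaterpillar G)
  (D : ℕ) (P : Fin (suc D) → Fin (suc (suc m)))
  (P-walk : ∀ (i : Fin D) → adj G (P (inject₁ i)) (P (Fin.suc i)) ≡ true)
  (P-ends : dist G (P Fin.zero) (P (fromℕ D)) ≡ D)
  (dist≤D : ∀ u v → dist G u v ≤ D)
  (1≤D : 1 ≤ D)
  where

  open GraphTheory G

  connected : Connected G
  connected = proj₁ (proj₁ caterpillar)

  n : ℕ
  n = suc (suc m)

  Q : ℕ → V
  Q t = P (clamp D t)

  Q-toℕ : ∀ i → Q (toℕ i) ≡ P i
  Q-toℕ i = cong P (clamp-toℕ i)

  Q-inject₁ : ∀ i → Q (toℕ i) ≡ P (inject₁ i)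
  Q-inject₁ i = ≡.trans (cong Q (≡.sym (Finₚ.toℕ-inject₁ i))) (Q-toℕ (inject₁ i))

  Q-walk : ∀ t → t < D → Q t ~ Q (suc t)
  Q-walk t t<D = subst (λ c → Q c ~ Q (suc c)) (Finₚ.toℕ-fromℕ< t<D) (walk-at (Fin.fromℕ< t<D))
    where
    walk-at : ∀ i → Q (toℕ i) ~ Q (suc (toℕ i))
    walk-at i = subst₂ _~_ (≡.sym (Q-inject₁ i)) (≡.sym (Q-toℕ (Fin.suc i))) (P-walk i)

  dist-Q≤ : ∀ a b → a ≤ D → b ≤ D → dist G (Q a) (Q b) ≤ ∣ a - b ∣
  dist-Q≤ = dist-along Q D Q-walk

  dist-Q-ends : dist G (Q 0) (Q D) ≡ D
  dist-Q-ends = ≡.trans (cong (λ i → dist G (P Fin.zero) (P i)) clamp-D) P-ends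
    where
    clamp-D : clamp D D ≡ fromℕ D
    clamp-D = ≡.trans (cong (clamp D) (≡.sym (Finₚ.toℕ-fromℕ D))) (clamp-toℕ (fromℕ D))

  dist-Q≥ : ∀ {a b} → a ≤ b → b ≤ D → b ∸ a ≤ dist G (Q a) (Q b)
  dist-Q≥ {a} {b} a≤b b≤D = m≤n+o⇒m∸n≤o b a (+-cancelʳ-≤ (D ∸ b) b (a + x) (begin
    b + (D ∸ b)                                         ≡⟨ m+[n∸m]≡n b≤D ⟩
    D                                                   ≡⟨ dist-Q-ends ⟨
    dist G (Q 0) (Q D)                                  ≤⟨ dist-triangle (Q 0) (Q a) (Q D) ⟩
    dist G (Q 0) (Q a) + dist G (Q a) (Q D)             ≤⟨ +-monoʳ-≤ (dist G (Q 0) (Q a)) (dist-triangle (Q a) (Q b) (Q D)) ⟩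
    dist G (Q 0) (Q a) + (x + dist G (Q b) (Q D))       ≤⟨ +-mono-≤ (dist-Q≤ 0 a z≤n a≤D) (+-monoʳ-≤ x (dist-Q≤ b D b≤D ≤-refl)) ⟩
    a + (x + ∣ b - D ∣)                                 ≡⟨ cong (λ c → a + (x + c)) (m≤n⇒∣m-n∣≡n∸m b≤D) ⟩
    a + (x + (D ∸ b))                                   ≡⟨ +-assoc a x (D ∸ b) ⟨
    a + x + (D ∸ b)                                     ∎))
    where
    open ≤-Reasoning
    x = dist G (Q a) (Q b)
    a≤D = ≤-trans a≤b b≤D

  dist-Q : ∀ {a b} → a ≤ D → b ≤ D → dist G (Q a) (Q b) ≡ ∣ a - b ∣
  dist-Q {a} {b} a≤D b≤D with ≤-total a b
  ... | inj₁ a≤b = ≤-antisym (dist-Q≤ a b a≤D b≤D)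
                             (subst (_≤ dist G (Q a) (Q b)) (≡.sym (m≤n⇒∣m-n∣≡n∸m a≤b)) (dist-Q≥ a≤b b≤D))
  ... | inj₂ b≤a = ≤-antisym (dist-Q≤ a b a≤D b≤D)
                             (subst₂ _≤_ (≡.sym (m≤n⇒∣n-m∣≡n∸m b≤a)) (dist-sym (Q b) (Q a)) (dist-Q≥ b≤a a≤D))

  Q-injective : ∀ {a b} → a ≤ D → b ≤ D → Q a ≡ Q b → a ≡ b
  Q-injective a≤D b≤D Qa≡Qb = ≡.trans (≡.sym (dist-Q z≤n a≤D)) (≡.trans (cong (dist G (Q 0)) Qa≡Qb) (dist-Q z≤n b≤D))

  toℕ≤D : (i : Fin (suc D)) → toℕ i ≤ D
  toℕ≤D = Finₚ.toℕ≤pred[n]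

  P-injective : ∀ {i j} → P i ≡ P j → i ≡ j
  P-injective {i} {j} Pi≡Pj =
    Finₚ.toℕ-injective (Q-injective (toℕ≤D i) (toℕ≤D j) (≡.trans (Q-toℕ i) (≡.trans Pi≡Pj (≡.sym (Q-toℕ j)))))

  dist<n : ∀ u v → dist G u v < n
  dist<n u v = ≤-trans (s≤s (dist≤D u v)) (Finₚ.injective⇒≤ P-injective)

  deg≥1 : ∀ v → 1 ≤ deg G v
  deg≥1 v with v Finₚ.≟ Q 0
  ... | no  v≢Q0 = connected⇒deg≥1 connected v≢Q0
  ... | yes refl = connected⇒deg≥1 connected (λ Q0≡Q1 → 0≢1+n (Q-injective z≤n 1≤D Q0≡Q1))

  nonLeaf⇒deg≥2 : ∀ v → NonLeaf G v → 2 ≤ deg G v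
  nonLeaf⇒deg≥2 v nonLeaf with deg G v | deg≥1 v
  ... | suc zero    | _ = ⊥-elim (nonLeaf refl)
  ... | suc (suc _) | _ = s≤s (s≤s z≤n)

  interior-nonLeaf : ∀ k → 1 ≤ k → suc k ≤ D → NonLeaf G (Q k)
  interior-nonLeaf (suc k) _ k+2≤D leaf = 1+n≰n (subst (2 ≤_) leaf (two-neighbours⇒deg≥2
    (~-sym (Q-walk k (<⇒≤ k+2≤D))) (Q-walk (suc k) k+2≤D)
    (λ Qk≡Qk+2 → k≢2+k (Q-injective (≤-trans (n≤1+n k) (<⇒≤ k+2≤D)) k+2≤D Qk≡Qk+2))))
    where
    k≢2+k : k ≢ suc (suc k)
    k≢2+k ()

  OffPath : V → Set
  OffPath w = ∀ {i} → i ≤ D → Q i ≢ w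

  dist-Q-pendant : ∀ {w k a} → OffPath w → Pendant w (Q k) → k ≤ D → a ≤ D → dist G (Q a) w ≡ suc ∣ a - k ∣
  dist-Q-pendant {w} {k} {a} off w-at-k k≤D a≤D = ≤-antisym upper lower
    where
    upper : dist G (Q a) w ≤ suc ∣ a - k ∣
    upper = begin
      dist G (Q a) w                         ≤⟨ dist-triangle (Q a) (Q k) w ⟩
      dist G (Q a) (Q k) + dist G (Q k) w    ≤⟨ +-mono-≤ (dist-Q≤ a k a≤D k≤D) (dist-adjacent (~-sym (proj₁ w-at-k))) ⟩
      ∣ a - k ∣ + 1                          ≡⟨ +-comm _ 1 ⟩
      suc ∣ a - k ∣                          ∎
      where open ≤-Reasoning
    lower : suc ∣ a - k ∣ ≤ dist G (Q a) w
    lower = begin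
      suc ∣ a - k ∣              ≡⟨ cong suc (≡.trans (∣-∣-comm a k) (≡.sym (dist-Q k≤D a≤D))) ⟩
      suc (dist G (Q k) (Q a))   ≤⟨ dist-pendant w-at-k (off a≤D) (dist<n w (Q a)) ⟩
      dist G w (Q a)             ≡⟨ dist-sym w (Q a) ⟩
      dist G (Q a) w             ∎
      where open ≤-Reasoning

  data Position (w : V) : Set where
    on-path : ∀ {i} → i ≤ D → Q i ≡ w → Position w
    pendant : ∀ {k} → 1 ≤ k → suc k ≤ D → OffPath w → Pendant w (Q k) → Position w

  on-path? : ∀ w → (∃ λ i → i ≤ D × Q i ≡ w) ⊎ OffPath w
  on-path? w with Finₚ.any? (λ i → P i Finₚ.≟ w)
  ... | yes (i , Pi≡w) = inj₁ (toℕ i , toℕ≤D i , ≡.trans (Q-toℕ i) Pi≡w)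
  ... | no  none       = inj₂ (λ {i} _ Qi≡w → none (clamp D i , Qi≡w))

  leaves-apart : ∀ {l l′ u u′} → l ≢ l′ → l ~ u → l′ ~ u′ → Leaf l → Leaf l′ → NonLeaf G u →
                 suc (suc (dist G u u′)) ≤ dist G l l′
  leaves-apart {l} {l′} {u} {u′} l≢l′ l~u l′~u′ leaf leaf′ nonLeaf = begin
    suc (suc (dist G u u′))   ≡⟨ cong (suc ∘ suc) (dist-sym u u′) ⟩
    suc (suc (dist G u′ u))   ≤⟨ s≤s (dist-pendant (leaf-pendant l′~u′ leaf′) (λ u≡l′ → nonLeaf (subst Leaf (≡.sym u≡l′) leaf′)) (dist<n l′ u)) ⟩
    suc (dist G l′ u)         ≡⟨ cong suc (dist-sym l′ u) ⟩
    suc (dist G u l′)         ≤⟨ dist-pendant (leaf-pendant l~u leaf) (l≢l′ ∘ ≡.sym) (dist<n l l′) ⟩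
    dist G l l′               ∎
    where open ≤-Reasoning

  position-all-leaves : (∀ v → ¬ NonLeaf G v) → ∀ w → Position w
  position-all-leaves no-nonLeaf w with on-path? w
  ... | inj₁ (i , i≤D , Qi≡w) = on-path i≤D Qi≡w
  ... | inj₂ off = ⊥-elim (neighbour-absurd (leaf⇒pendant w (leaf w)))
    where
    leaf : ∀ v → Leaf v
    leaf v = decidable-stable (leaf? v) (no-nonLeaf v)

    neighbour-absurd : ∃ (Pendant w) → ⊥
    neighbour-absurd (u , w~u , _)
      with adjacent-leaves-cover connected w~u (leaf w) (leaf u) (Q 0)
         | adjacent-leaves-cover connected w~u (leaf w) (leaf u) (Q 1)
    ... | inj₁ Q0≡w | _         = off z≤n Q0≡w
    ... | inj₂ _    | inj₁ Q1≡w = off 1≤D Q1≡w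
    ... | inj₂ Q0≡u | inj₂ Q1≡u = 0≢1+n (Q-injective z≤n 1≤D (≡.trans Q0≡u (≡.sym Q1≡u)))

  module Spine (s : ℕ) (W : Fin (suc s) → V) (W-injective : Injective _≡_ _≡_ W)
               (W-nonLeaf : ∀ i → NonLeaf G (W i)) (W-onto : ∀ v → NonLeaf G v → ∃ λ i → W i ≡ v)
               (W-adjacent : ∀ i j → W i ~ W j → (toℕ i ≡ suc (toℕ j)) ⊎ (toℕ j ≡ suc (toℕ i)))
               where

    leaf-neighbour-nonLeaf : ∀ {w u} → w ~ u → Leaf w → NonLeaf G u
    leaf-neighbour-nonLeaf w~u leaf leaf-u with adjacent-leaves-cover connected w~u leaf leaf-u (W Fin.zero)
    ... | inj₁ W₀≡w = W-nonLeaf Fin.zero (subst Leaf (≡.sym W₀≡w) leaf)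
    ... | inj₂ W₀≡u = W-nonLeaf Fin.zero (subst Leaf (≡.sym W₀≡u) leaf-u)

    -- Opaque so that case splits on leaf? elsewhere do not unfold it.
    opaque
      anchor : ∀ w → Σ (Fin (suc s)) λ a → (NonLeaf G w → W a ≡ w) × (Leaf w → Pendant w (W a))
      anchor w with leaf? w
      ... | no nonLeaf with a , Wa≡w ← W-onto w nonLeaf = a , (λ _ → Wa≡w) , (⊥-elim ∘ nonLeaf)
      ... | yes leaf with u , w~u , uniq ← leaf⇒pendant w leaf with a , refl ← W-onto u (leaf-neighbour-nonLeaf w~u leaf) =
        a , (λ nonLeaf → ⊥-elim (nonLeaf leaf)) , (λ _ → w~u , uniq)

    spine-index : V → ℕ
    spine-index w = toℕ (proj₁ (anchor w))

    anchor-nonLeaf : ∀ w → NonLeaf G w → W (proj₁ (anchor w)) ≡ w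
    anchor-nonLeaf w = proj₁ (proj₂ (anchor w))

    anchor-leaf : ∀ w → Leaf w → Pendant w (W (proj₁ (anchor w)))
    anchor-leaf w = proj₂ (proj₂ (anchor w))

    spine-index-W : ∀ i → spine-index (W i) ≡ toℕ i
    spine-index-W i = cong toℕ (W-injective (anchor-nonLeaf (W i) (W-nonLeaf i)))

    same-anchor : ∀ {x y} → x ~ y → Leaf x → NonLeaf G y → proj₁ (anchor x) ≡ proj₁ (anchor y)
    same-anchor {x} {y} x~y leaf-x nonLeaf-y =
      W-injective (≡.sym (≡.trans (anchor-nonLeaf y nonLeaf-y) (proj₂ (anchor-leaf x leaf-x) y x~y)))

    spine-index-lipschitz : Lipschitz spine-index
    spine-index-lipschitz {x} {y} x~y with leaf? x | leaf? y
    ... | yes leaf-x   | yes leaf-y   = ⊥-elim (leaf-neighbour-nonLeaf x~y leaf-x leaf-y)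
    ... | yes leaf-x   | no nonLeaf-y = ≤-trans (≤-reflexive (cong toℕ (same-anchor x~y leaf-x nonLeaf-y))) (n≤1+n _)
    ... | no nonLeaf-x | yes leaf-y   = ≤-trans (≤-reflexive (cong toℕ (≡.sym (same-anchor (~-sym x~y) leaf-y nonLeaf-x)))) (n≤1+n _)
    ... | no nonLeaf-x | no nonLeaf-y
      with W-adjacent _ _ (subst₂ _~_ (≡.sym (anchor-nonLeaf x nonLeaf-x)) (≡.sym (anchor-nonLeaf y nonLeaf-y)) x~y)
    ...   | inj₁ x≡1+y = ≤-reflexive x≡1+y
    ...   | inj₂ y≡1+x = ≤-trans (n≤1+n (spine-index x)) (≤-trans (≤-reflexive (≡.sym y≡1+x)) (n≤1+n (spine-index y)))

    end-leaf : ∀ a → (∀ {b c} → W a ~ W b → W a ~ W c → b ≡ c) → ∃ λ l → Leaf l × l ~ W a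
    end-leaf a lone with x , y , x≢y , a~x , a~y ← deg≥2⇒two-neighbours (W a) (nonLeaf⇒deg≥2 (W a) (W-nonLeaf a))
      with leaf? x | leaf? y
    ... | yes leaf-x | _          = x , leaf-x , ~-sym a~x
    ... | no _       | yes leaf-y = y , leaf-y , ~-sym a~y
    ... | no nonLeaf-x | no nonLeaf-y with b , refl ← W-onto x nonLeaf-x with c , refl ← W-onto y nonLeaf-y =
      ⊥-elim (x≢y (cong W (lone a~x a~y)))

    span≤D : ∀ {l l′ a b} → l ≢ l′ → l ~ W a → l′ ~ W b → Leaf l → Leaf l′ → suc (suc (toℕ a ∸ toℕ b)) ≤ D
    span≤D {l} {l′} {a} {b} l≢l′ l~Wa l′~Wb leaf leaf′ = begin
      suc (suc (toℕ a ∸ toℕ b))                          ≡⟨ cong₂ (λ i j → suc (suc (i ∸ j))) (spine-index-W a) (spine-index-W b) ⟨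
      suc (suc (spine-index (W a) ∸ spine-index (W b)))  ≤⟨ s≤s (s≤s (dist-lipschitz spine-index spine-index-lipschitz (W a) (W b) (dist<n (W a) (W b)))) ⟩
      suc (suc (dist G (W a) (W b)))                     ≤⟨ leaves-apart l≢l′ l~Wa l′~Wb leaf leaf′ (W-nonLeaf a) ⟩
      dist G l l′                                        ≤⟨ dist≤D l l′ ⟩
      D                                                  ∎
      where open ≤-Reasoning

    first-spine-neighbour : ∀ {b} → W Fin.zero ~ W b → toℕ b ≡ 1
    first-spine-neighbour {b} W₀~Wb with W-adjacent Fin.zero b W₀~Wb
    ... | inj₂ b≡1 = b≡1

    last-spine-neighbour : ∀ {b} → W (fromℕ s) ~ W b → suc (toℕ b) ≡ s
    last-spine-neighbour {b} Wₛ~Wb with W-adjacent (fromℕ s) b Wₛ~Wb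
    ... | inj₁ s≡1+b = ≡.trans (≡.sym s≡1+b) (Finₚ.toℕ-fromℕ s)
    ... | inj₂ b≡2+s = ⊥-elim (1+n≰n (subst₂ _≤_ (≡.trans b≡2+s (cong suc (Finₚ.toℕ-fromℕ s))) refl (Finₚ.toℕ≤pred[n] b)))

    first-spine-neighbour-unique : ∀ {b c} → W Fin.zero ~ W b → W Fin.zero ~ W c → b ≡ c
    first-spine-neighbour-unique W~b W~c = Finₚ.toℕ-injective (≡.trans (first-spine-neighbour W~b) (≡.sym (first-spine-neighbour W~c)))

    last-spine-neighbour-unique : ∀ {b c} → W (fromℕ s) ~ W b → W (fromℕ s) ~ W c → b ≡ c
    last-spine-neighbour-unique W~b W~c = Finₚ.toℕ-injective (suc-injective (≡.trans (last-spine-neighbour W~b) (≡.sym (last-spine-neighbour W~c))))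

    singleton-neighbour-leaf : s ≡ 0 → ∀ {v} → W Fin.zero ~ v → Leaf v
    singleton-neighbour-leaf s≡0 {v} W₀~v = decidable-stable (leaf? v) (not-on-spine ∘ W-onto v)
      where
      not-on-spine : ∄ λ c → W c ≡ v
      not-on-spine (c , refl) = 1+n≰n (subst₂ _≤_ (first-spine-neighbour W₀~v) s≡0 (Finₚ.toℕ≤pred[n] c))

    ends-distinct : s ≢ 0 → ∀ {l l′} → l ~ W (fromℕ s) → l′ ~ W Fin.zero → Leaf l → l ≢ l′
    ends-distinct s≢0 l~Wₛ l′~W₀ leaf refl =
      s≢0 (≡.trans (≡.sym (Finₚ.toℕ-fromℕ s)) (cong toℕ (W-injective (leaf-neighbour-unique l~Wₛ l′~W₀ leaf))))

    s+2≤D : suc (suc s) ≤ D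
    s+2≤D with s ℕ.≟ 0
    ... | yes s≡0 with x , y , x≢y , W₀~x , W₀~y ← deg≥2⇒two-neighbours (W Fin.zero) (nonLeaf⇒deg≥2 (W Fin.zero) (W-nonLeaf Fin.zero)) =
      subst (λ t → suc (suc t) ≤ D) (≡.sym s≡0)
        (span≤D {a = Fin.zero} {b = Fin.zero} x≢y (~-sym W₀~x) (~-sym W₀~y) (singleton-neighbour-leaf s≡0 W₀~x) (singleton-neighbour-leaf s≡0 W₀~y))
    ... | no s≢0 = long-spine s≢0 (end-leaf (fromℕ s) last-spine-neighbour-unique) (end-leaf Fin.zero first-spine-neighbour-unique)
      where
      long-spine : s ≢ 0 → (∃ λ l → Leaf l × l ~ W (fromℕ s)) → (∃ λ l′ → Leaf l′ × l′ ~ W Fin.zero) → suc (suc s) ≤ D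
      long-spine s≢0 (l , leaf , l~Wₛ) (l′ , leaf′ , l′~W₀) = subst (λ t → suc (suc t) ≤ D) (Finₚ.toℕ-fromℕ s)
        (span≤D {a = fromℕ s} {b = Fin.zero} (ends-distinct s≢0 l~Wₛ l′~W₀ leaf) l~Wₛ l′~W₀ leaf leaf′)

    interior-bound : (t : Fin (D ∸ 1)) → suc (suc (toℕ t)) ≤ D
    interior-bound t = ≤-trans (s≤s (Finₚ.toℕ<n t)) (≤-reflexive (m+[n∸m]≡n 1≤D))

    interior-on-spine : (t : Fin (D ∸ 1)) → ∃ λ a → W a ≡ Q (suc (toℕ t))
    interior-on-spine t = W-onto (Q (suc (toℕ t))) (interior-nonLeaf (suc (toℕ t)) (s≤s z≤n) (interior-bound t))

    interior-injective : Injective _≡_ _≡_ (proj₁ ∘ interior-on-spine)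
    interior-injective {t} {t′} e = Finₚ.toℕ-injective (suc-injective (Q-injective (<⇒≤ (interior-bound t)) (<⇒≤ (interior-bound t′))
      (≡.trans (≡.sym (proj₂ (interior-on-spine t))) (≡.trans (cong W e) (proj₂ (interior-on-spine t′))))))

    -- The D − 1 interior path vertices are distinct non-leaves and s + 1 ≤ D − 1, so they exhaust the spine.
    spine-interior : ∀ a → ∃ λ k → 1 ≤ k × suc k ≤ D × Q k ≡ W a
    spine-interior a = hit (injective⇒surjective interior-injective (∸-monoˡ-≤ 1 s+2≤D) a)
      where
      hit : ∃ (λ t → proj₁ (interior-on-spine t) ≡ a) → ∃ λ k → 1 ≤ k × suc k ≤ D × Q k ≡ W a
      hit (t , refl) = suc (toℕ t) , s≤s z≤n , interior-bound t , ≡.sym (proj₂ (interior-on-spine t))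

    position : ∀ w → Position w
    position w with on-path? w
    ... | inj₁ (i , i≤D , Qi≡w) = on-path i≤D Qi≡w
    ... | inj₂ off = attached (spine-interior (proj₁ (anchor w))) (leaf? w)
      where
      attached : (∃ λ k → 1 ≤ k × suc k ≤ D × Q k ≡ W (proj₁ (anchor w))) → Dec (Leaf w) → Position w
      attached (k , 1≤k , k<D , Qk≡Wa) (yes leaf)    = pendant 1≤k k<D off (subst (Pendant w) (≡.sym Qk≡Wa) (anchor-leaf w leaf))
      attached (k , _   , k<D , Qk≡Wa) (no  nonLeaf) = ⊥-elim (off (<⇒≤ k<D) (≡.trans Qk≡Wa (anchor-nonLeaf w nonLeaf)))

  position : ∀ w → Position w
  position with proj₂ caterpillar
  ... | inj₁ no-nonLeaf = position-all-leaves no-nonLeaf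
  ... | inj₂ (s , W , W-injective , W-nonLeaf , W-onto , _ , W-adjacent) =
    Spine.position s W W-injective W-nonLeaf W-onto W-adjacent

  dist-consecutive-odd : ∀ {j} → suc j ≤ D → ∀ w → ∃ λ q → dist G (Q j) w + dist G (Q (suc j)) w ≡ suc (q + q)
  dist-consecutive-odd {j} j<D w with position w
  ... | on-path {i} i≤D refl with q , eq ← ∣-∣-consecutive-odd j i =
    q , ≡.trans (cong₂ _+_ (dist-Q (<⇒≤ j<D) i≤D) (dist-Q j<D i≤D)) eq
  ... | pendant {k} _ k<D off w-at-k with q , eq ← ∣-∣-consecutive-odd j k = suc q , (begin
    dist G (Q j) w + dist G (Q (suc j)) w  ≡⟨ cong₂ _+_ (dist-Q-pendant off w-at-k (<⇒≤ k<D) (<⇒≤ j<D))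
                                                        (dist-Q-pendant off w-at-k (<⇒≤ k<D) j<D) ⟩
    suc ∣ j - k ∣ + suc ∣ suc j - k ∣      ≡⟨ cong suc (+-suc ∣ j - k ∣ ∣ suc j - k ∣) ⟩
    suc (suc (∣ j - k ∣ + ∣ suc j - k ∣))  ≡⟨ cong (suc ∘ suc) eq ⟩
    suc (suc (suc (q + q)))                ≡⟨ cong suc (+-suc (suc q) q) ⟨
    suc (suc q + suc q)                    ∎)
    where open ≡-Reasoning

  dist-midpoint≤ : ∀ w → dist G (Q ⌊ D /2⌋) w ≤ ⌈ D /2⌉
  dist-midpoint≤ w with position w
  ... | on-path {i} i≤D refl = subst (_≤ ⌈ D /2⌉) (≡.sym (dist-Q (⌊n/2⌋≤n D) i≤D))
    (m≤o⇒n≤m+o⇒∣m-n∣≤o (⌊n/2⌋≤⌈n/2⌉ D) (subst (i ≤_) (≡.sym (⌊n/2⌋+⌈n/2⌉≡n D)) i≤D))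
  ... | pendant 1≤k k<D off w-at-k = subst (_≤ ⌈ D /2⌉) (≡.sym (dist-Q-pendant off w-at-k (<⇒≤ k<D) (⌊n/2⌋≤n D)))
    (m≤o⇒1≤n⇒n<m+o⇒1+∣m-n∣≤o (⌊n/2⌋≤⌈n/2⌉ D) 1≤k (subst (_ ≤_) (≡.sym (⌊n/2⌋+⌈n/2⌉≡n D)) k<D))

  multiplicity : V → ℕ
  multiplicity w = sum (λ i → δ (P i) w)

  sum-multiplicity : sum multiplicity ≡ suc D
  sum-multiplicity = begin
    sum (λ w → sum (λ i → δ (P i) w))    ≡⟨ ∑-comm (λ w i → δ (P i) w) ⟩
    sum (λ i → sum (δ (P i)))            ≡⟨ sum-cong-≗ (sum-δ ∘ P) ⟩
    sum {suc D} (λ _ → 1)                ≡⟨ sum-const (suc D) 1 ⟩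
    suc D * 1                            ≡⟨ *-identityʳ (suc D) ⟩
    suc D                                ∎
    where open ≡-Reasoning

  dist-ends+multiplicity : ∀ w → suc D ≤ dist G (Q 0) w + dist G (Q D) w + multiplicity w
  dist-ends+multiplicity w with position w
  ... | on-path {i} i≤D refl = begin
    suc D                                           ≡⟨ +-comm 1 D ⟩
    D + 1                                           ≡⟨ cong (_+ 1) (m+[n∸m]≡n i≤D) ⟨
    i + (D ∸ i) + 1                                 ≤⟨ +-monoʳ-≤ (i + (D ∸ i)) 1≤multiplicity ⟩
    i + (D ∸ i) + multiplicity (Q i)                ≡⟨ cong (λ e → e + multiplicity (Q i)) (cong₂ _+_
                                                         (≡.sym (dist-Q z≤n i≤D))
                                                         (≡.trans (≡.sym (m≤n⇒∣n-m∣≡n∸m i≤D)) (≡.sym (dist-Q ≤-refl i≤D)))) ⟩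
    dist G (Q 0) (Q i) + dist G (Q D) (Q i) + multiplicity (Q i) ∎
    where
    open ≤-Reasoning
    1≤multiplicity : 1 ≤ multiplicity (Q i)
    1≤multiplicity = subst (_≤ multiplicity (Q i)) (δ-refl (Q i)) (term≤sum (λ i′ → δ (P i′) (Q i)) (clamp D i))
  ... | pendant {k} _ k<D off w-at-k = begin
    suc D                                           ≡⟨ cong suc (m+[n∸m]≡n (<⇒≤ k<D)) ⟨
    suc (k + (D ∸ k))                               ≤⟨ s≤s (+-monoʳ-≤ k (n≤1+n (D ∸ k))) ⟩
    suc k + suc (D ∸ k)                             ≡⟨ cong₂ _+_
                                                         (≡.sym (dist-Q-pendant off w-at-k (<⇒≤ k<D) z≤n))
                                                         (≡.trans (cong suc (≡.sym (m≤n⇒∣n-m∣≡n∸m (<⇒≤ k<D))))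
                                                                  (≡.sym (dist-Q-pendant off w-at-k (<⇒≤ k<D) ≤-refl))) ⟩
    dist G (Q 0) w + dist G (Q D) w                 ≤⟨ m≤m+n _ (multiplicity w) ⟩
    dist G (Q 0) w + dist G (Q D) w + multiplicity w ∎
    where open ≤-Reasoning

  ends-transmission : suc m * suc D ≤ trans G (Q 0) + trans G (Q D)
  ends-transmission = +-cancelʳ-≤ (suc D) _ _ (begin
    suc m * suc D + suc D                                      ≡⟨ +-comm (suc m * suc D) (suc D) ⟩
    n * suc D                                                  ≡⟨ sum-const n (suc D) ⟨
    sum {n} (λ _ → suc D)                                      ≤⟨ sum-mono-≤ dist-ends+multiplicity ⟩
    sum (λ w → dist G (Q 0) w + dist G (Q D) w + multiplicity w) ≡⟨ ∑-distrib-+ (λ w → dist G (Q 0) w + dist G (Q D) w) multiplicity ⟩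
    sum (λ w → dist G (Q 0) w + dist G (Q D) w) + sum multiplicity
      ≡⟨ cong₂ _+_ (∑-distrib-+ (dist G (Q 0)) (dist G (Q D))) sum-multiplicity ⟩
    sum (dist G (Q 0)) + sum (dist G (Q D)) + suc D            ≡⟨ cong (_+ suc D) (cong₂ _+_ (trans≡sum (Q 0)) (trans≡sum (Q D))) ⟨
    trans G (Q 0) + trans G (Q D) + suc D                      ∎)
    where open ≤-Reasoning

  order-even : ∀ {j} → suc j ≤ D → trans G (Q j) ≡ trans G (Q (suc j)) → ∃ λ h → n ≡ h + h
  order-even {j} j<D T≡T′ = t ∸ sum q , t+t≡k+[h+h]⇒k≡[t∸h]+[t∸h] n t (sum q) (begin
    t + t                                              ≡⟨ cong (t +_) T≡T′ ⟩
    t + trans G (Q (suc j))                            ≡⟨ cong₂ _+_ (trans≡sum (Q j)) (trans≡sum (Q (suc j))) ⟩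
    sum (dist G (Q j)) + sum (dist G (Q (suc j)))      ≡⟨ ∑-distrib-+ (dist G (Q j)) (dist G (Q (suc j))) ⟨
    sum (λ w → dist G (Q j) w + dist G (Q (suc j)) w)  ≡⟨ sum-cong-≗ (proj₂ ∘ dist-consecutive-odd j<D) ⟩
    sum (λ w → suc (q w + q w))                        ≡⟨ sum-suc (λ w → q w + q w) ⟩
    n + sum (λ w → q w + q w)                          ≡⟨ cong (n +_) (∑-distrib-+ q q) ⟩
    n + (sum q + sum q)                                ∎)
    where
    open ≡-Reasoning
    t = trans G (Q j)
    q = proj₁ ∘ dist-consecutive-odd j<D

  radius≤⌈D/2⌉ : radius G ≤ ⌈ D /2⌉
  radius≤⌈D/2⌉ = ≤-trans (fold1-⊓-lower ⊓-operator (ecc G) (Q ⌊ D /2⌋))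
                         (fold1-⊔-least ⊔-operator (dist G (Q ⌊ D /2⌋)) dist-midpoint≤)

  half-diameter-transmissions : ⌈ D /2⌉ * suc m + ⌈ D /2⌉ * suc m ≤ trans G (Q 0) + trans G (Q D)
  half-diameter-transmissions = begin
    E * suc m + E * suc m           ≡⟨ *-distribʳ-+ (suc m) E E ⟨
    (E + E) * suc m                 ≤⟨ *-monoˡ-≤ (suc m) (≤-trans (+-monoʳ-≤ E (⌊n/2⌋≤⌈n/2⌉ (suc D))) (≤-reflexive (⌊n/2⌋+⌈n/2⌉≡n (suc D)))) ⟩
    suc D * suc m                   ≡⟨ *-comm (suc D) (suc m) ⟩
    suc m * suc D                   ≤⟨ ends-transmission ⟩
    trans G (Q 0) + trans G (Q D)   ∎
    where
    open ≤-Reasoning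
    E = ⌈ D /2⌉

  ⌈D/2⌉≤remoteness : ℕ→ℚ ⌈ D /2⌉ ≤ℚ remoteness G
  ⌈D/2⌉≤remoteness = [ ℕ→ℚ≤remoteness G (Q 0) ⌈ D /2⌉ , ℕ→ℚ≤remoteness G (Q D) ⌈ D /2⌉ ]′
    (x+x≤y+z⇒x≤y⊎x≤z (⌈ D /2⌉ * suc m) (trans G (Q 0)) (trans G (Q D)) half-diameter-transmissions)

  radius≤remoteness : ℕ→ℚ (radius G) ≤ℚ remoteness G
  radius≤remoteness = ℚₚ.≤-trans (ℕ→ℚ-mono-≤ (radius G) ⌈ D /2⌉ radius≤⌈D/2⌉) ⌈D/2⌉≤remoteness

-- Paths

module PathGraph (N : ℕ) where

  open GraphTheory (pathGraph (suc N))

  d : Fin (suc N) → Fin (suc N) → ℕ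
  d = dist (pathGraph (suc N))

  path-walk : ∀ t → t < N → clamp N t ~ clamp N (suc t)
  path-walk t t<N = ∨-introʳ _ (Equivalence.to T-≡ (≡⇒≡ᵇ _ _ (≡.trans (toℕ-clamp t<N) (cong suc (≡.sym (toℕ-clamp (<⇒≤ t<N)))))))

  dist-path≤ : ∀ i k → d i k ≤ ∣ toℕ i - toℕ k ∣
  dist-path≤ i k = subst₂ (λ a b → d a b ≤ ∣ toℕ i - toℕ k ∣) (clamp-toℕ i) (clamp-toℕ k)
    (dist-along (clamp N) N path-walk (toℕ i) (toℕ k) (Finₚ.toℕ≤pred[n] i) (Finₚ.toℕ≤pred[n] k))

  toℕ-lipschitz : Lipschitz toℕ
  toℕ-lipschitz {x} {y} x~y with ∨-elim (toℕ x ℕ.≡ᵇ suc (toℕ y)) x~y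
  ... | inj₁ x≡1+y = ≤-reflexive (≡ᵇ⇒≡ _ _ (Equivalence.from T-≡ x≡1+y))
  ... | inj₂ y≡1+x = ≤-trans (n≤1+n (toℕ x)) (≤-trans (≤-reflexive (≡.sym (≡ᵇ⇒≡ _ _ (Equivalence.from T-≡ y≡1+x)))) (n≤1+n (toℕ y)))

  dist-path≥ : ∀ i k → toℕ i ∸ toℕ k ≤ d i k
  dist-path≥ i k = dist-lipschitz toℕ toℕ-lipschitz i k
    (s≤s (≤-trans (dist-path≤ i k) (≤-trans (∣m-n∣≤m⊔n (toℕ i) (toℕ k)) (⊔-lub (Finₚ.toℕ≤pred[n] i) (Finₚ.toℕ≤pred[n] k)))))

  transmission-path≤ : ∀ i → 2 * trans (pathGraph (suc N)) i ≤ suc N * N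
  transmission-path≤ i = begin
    2 * trans (pathGraph (suc N)) i               ≡⟨ cong (2 *_) (trans≡sum i) ⟩
    2 * sum (d i)                                 ≤⟨ *-monoʳ-≤ 2 (sum-mono-≤ (dist-path≤ i)) ⟩
    2 * sum {suc N} (λ k → ∣ toℕ i - toℕ k ∣)     ≤⟨ sum-∣-∣≤ N (toℕ i) (Finₚ.toℕ≤pred[n] i) ⟩
    suc N * N                                     ∎
    where open ≤-Reasoning

  half≤ecc : ∀ {h} → h + h ≡ suc N → ∀ i → h ≤ ecc (pathGraph (suc N)) i
  half≤ecc {h} h+h≡n i with h ≤? toℕ i
  ... | yes h≤i = ≤-trans h≤i (≤-trans (dist-path≥ i Fin.zero) (fold1-⊔-upper ⊔-operator (d i) Fin.zero))
  ... | no  h≰i = begin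
    h                           ≡⟨ m+n∸m≡n (toℕ i) h ⟨
    toℕ i + h ∸ toℕ i           ≤⟨ ∸-monoˡ-≤ (toℕ i) (ℕ.s≤s⁻¹ (subst (suc (toℕ i) + h ≤_) h+h≡n (+-monoˡ-≤ h (≰⇒> h≰i)))) ⟩
    N ∸ toℕ i                   ≡⟨ cong (_∸ toℕ i) (Finₚ.toℕ-fromℕ N) ⟨
    toℕ (fromℕ N) ∸ toℕ i       ≤⟨ dist-path≥ (fromℕ N) i ⟩
    d (fromℕ N) i               ≡⟨ dist-sym (fromℕ N) i ⟩
    d i (fromℕ N)               ≤⟨ fold1-⊔-upper ⊔-operator (d i) (fromℕ N) ⟩
    ecc (pathGraph (suc N)) i   ∎
    where open ≤-Reasoning

path-remoteness≤radius : ∀ m h → suc (suc m) ≡ h + h →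
  remoteness (pathGraph (suc (suc m))) ≤ℚ ℕ→ℚ (radius (pathGraph (suc (suc m))))
path-remoteness≤radius m h n≡h+h =
  ℚₚ.≤-trans (remoteness≤ℕ→ℚ Pₙ h transmission≤) (ℕ→ℚ-mono-≤ h (radius Pₙ) h≤radius)
  where
  open PathGraph (suc m)
  Pₙ = pathGraph (suc (suc m))

  transmission≤ : ∀ i → trans Pₙ i ≤ h * suc m
  transmission≤ i = *-cancelˡ-≤ 2 (begin
    2 * trans Pₙ i            ≤⟨ transmission-path≤ i ⟩
    suc (suc m) * suc m       ≡⟨ cong (_* suc m) n≡h+h ⟩
    (h + h) * suc m           ≡⟨ *-distribʳ-+ (suc m) h h ⟩
    h * suc m + h * suc m     ≡⟨ cong (h * suc m +_) (+-identityʳ (h * suc m)) ⟨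
    2 * (h * suc m)           ∎)
    where open ≤-Reasoning

  h≤radius : h ≤ radius Pₙ
  h≤radius = fold1-⊓-greatest ⊓-operator (ecc Pₙ) (half≤ecc (≡.sym n≡h+h))

lemma17 : (m : ℕ) (G : Graph (suc (suc m))) →
    IsCaterpillar G →
    ¬ (G ≅ pathGraph (suc (suc m))) →
    (P : Fin (suc (diameter G)) → Fin (suc (suc m))) →
    (∀ (i : Fin (diameter G)) → adj G (P (inject₁ i)) (P (Fin.suc i)) ≡ true) →
    dist G (P Fin.zero) (P (fromℕ (diameter G))) ≡ diameter G →
    (j : Fin (diameter G)) →
    Centroidal G (P (inject₁ j)) →
    Centroidal G (P (Fin.suc j)) →
    (∀ c → Centroidal G c → (c ≡ P (inject₁ j)) ⊎ (c ≡ P (Fin.suc j))) →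
    deg G (P (inject₁ j)) ≡ deg G (P (Fin.suc j)) →
    (∀ (i : Fin (suc (diameter G))) → toℕ i ≢ toℕ j → toℕ i ≢ suc (toℕ j) → deg G (P i) ≤ 2) →
    remoteness (pathGraph (suc (suc m))) - ℕ→ℚ (radius (pathGraph (suc (suc m))))
    ≤ℚ remoteness G - ℕ→ℚ (radius G)
lemma17 m G caterpillar _ P P-walk P-ends j centroidal centroidal′ _ _ _ =
  p≤q⇒s≤r⇒p-q≤r-s (path-remoteness≤radius m (proj₁ n-even) (proj₂ n-even)) radius≤remoteness
  where
  j<D = Finₚ.toℕ<n j
  open DiametricPath G caterpillar (diameter G) P P-walk P-ends (dist≤diameter G) (≤-trans (s≤s z≤n) j<D)

  equal-transmissions : trans G (Q (toℕ j)) ≡ trans G (Q (suc (toℕ j)))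
  equal-transmissions = begin
    trans G (Q (toℕ j))            ≡⟨ cong (trans G) (Q-inject₁ j) ⟩
    trans G (P (inject₁ j))        ≡⟨ ℕ/-injective (trans G (P (inject₁ j))) (trans G (P (Fin.suc j))) m
                                                   (≡.trans centroidal (≡.sym centroidal′)) ⟩
    trans G (P (Fin.suc j))        ≡⟨ cong (trans G) (Q-toℕ (Fin.suc j)) ⟨
    trans G (Q (suc (toℕ j)))      ∎
    where open ≡-Reasoning

  n-even : ∃ λ h → suc (suc m) ≡ h + h
  n-even = order-even j<D equal-transmissions
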